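{- Let $m,n\in\mathbb{N}$. Let $\mathfrak{a}_1=(A_1,=)$ be an antichain on an $m$-element set $A_1$ and $\mathfrak{a}_2=(A_2,=)$ an antichain on an $n$-element set $A_2$ disjoint from $A_1$, and let $\mathfrak{A}^{\bullet}_{m,n}$ denote the set of proper mergings of $\mathfrak{a}_1$ and $\mathfrak{a}_2$. Then \[ \left\lvert\mathfrak{A}^{\bullet}_{m,n}\right\rvert=\sum_{\substack{n_1+m_1+k_1=m\\ n_1,m_1,k_1\ge 0}}\binom{m}{n_1,m_1,k_1}(-1)^{k_1}\Bigl(2^{n_1}+2^{m_1}-1\Bigr)^{n}. \]
   Context: An antichain $(A,=)$ is a set ordered by equality (any two distinct elements incomparable). $\binom{m}{n_1,m_1,k_1}$ is the multinomial coefficient. A quasi-order is a reflexive, transitive binary relation. For disjoint quasi-ordered sets $(P,\leftarrow_P)$, $(Q,\leftarrow_Q)$ and relations $R\subseteq P\times Q$, $S\subseteq Q\times P$, define $\leftarrow_{R,S}$ on $P\cup Q$ by: $p\leftarrow_{R,S}q$ iff $p\leftarrow_P q$ or $p\leftarrow_Q q$ or $(p,q)\in R$ or $(p,q)\in S$. $(R,S)$ is a merging of $P$ and $Q$ if $\leftarrow_{R,S}$ is a quasi-order on $P\cup Q$, and a proper merging if additionally $R\cap S^{ -1}=\emptyset$. Mergings are counted as pairs $(R,S)$ of relations. -}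

module Defs where

open import Data.Nat as ℕ using (ℕ; zero; suc; _∸_; _!)
open import Data.Nat.Properties using (_!≢0; m*n≢0)
open import Data.Integer as ℤ using (ℤ; +_; -_)
open import Data.Bool using (Bool; true; false)
open import Data.Fin using (Fin)
open import Data.Vec using (Vec; lookup)
open import Data.Sum using (_⊎_; inj₁; inj₂)
open import Data.Product using (_×_; _,_)
open import Data.List using (List; sum; map; upTo; length)
open import Data.List.Relation.Unary.Unique.Propositional using (Unique)
open import Data.List.Membership.Propositional using (_∈_)
open import Relation.Binary.PropositionalEquality using (_≡_)
open import Relation.Nullary using (¬_)
open import Function.Bundles using (_⇔_)

-- The antichain a₁ lives on A₁ = Fin m, the antichain a₂ on A₂ = Fin n;
-- their disjoint union is Fin m ⊎ Fin n.
-- A relation R ⊆ A₁ × A₂ is represented by its Boolean incidence matrix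
-- (so that equality of relations is structural equality).
Rel₁₂ : ℕ → ℕ → Set
Rel₁₂ m n = Vec (Vec Bool n) m

_∋⟨_,_⟩ : ∀ {m n} → Rel₁₂ m n → Fin m → Fin n → Set
R ∋⟨ a , b ⟩ = lookup (lookup R a) b ≡ true

MergedRel : ∀ {m n} → Rel₁₂ m n → Rel₁₂ n m → Fin m ⊎ Fin n → Fin m ⊎ Fin n → Set
MergedRel R S (inj₁ a) (inj₁ a′) = a ≡ a′
MergedRel R S (inj₂ b) (inj₂ b′) = b ≡ b′
MergedRel R S (inj₁ a) (inj₂ b)  = R ∋⟨ a , b ⟩
MergedRel R S (inj₂ b) (inj₁ a)  = S ∋⟨ b , a ⟩

IsQuasiOrder : ∀ {X : Set} → (X → X → Set) → Set
IsQuasiOrder {X} _≤_ = (∀ x → x ≤ x) × (∀ x y z → x ≤ y → y ≤ z → x ≤ z)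

IsMerging : ∀ {m n} → Rel₁₂ m n → Rel₁₂ n m → Set
IsMerging R S = IsQuasiOrder (MergedRel R S)

IsProperMerging : ∀ {m n} → Rel₁₂ m n → Rel₁₂ n m → Set
IsProperMerging {m} {n} R S =
  IsMerging R S × (∀ (a : Fin m) (b : Fin n) → ¬ (R ∋⟨ a , b ⟩ × S ∋⟨ b , a ⟩))

NumProperMergings : ℕ → ℕ → ℕ → Set
NumProperMergings m n N =
  Data.Product.Σ (List (Rel₁₂ m n × Rel₁₂ n m)) λ L →
    Unique L × (∀ R S → ((R , S) ∈ L) ⇔ IsProperMerging R S) × length L ≡ N

multinomial : ℕ → ℕ → ℕ → ℕ → ℕ
multinomial m n₁ m₁ k₁ =
  (m ! ℕ./ ((n₁ ! ℕ.* m₁ !) ℕ.* k₁ !))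
    {{m*n≢0 _ _ {{m*n≢0 _ _ {{n₁ !≢0}} {{m₁ !≢0}}}} {{k₁ !≢0}}}}

sumℤ : List ℤ → ℤ
sumℤ = Data.List.foldr ℤ._+_ (+ 0)

term : ℕ → ℕ → ℕ → ℕ → ℕ → ℤ
term m n n₁ m₁ k₁ =
  (+ multinomial m n₁ m₁ k₁) ℤ.* ((- + 1) ℤ.^ k₁)
    ℤ.* ((+ (2 ℕ.^ n₁) ℤ.+ + (2 ℕ.^ m₁) ℤ.- + 1) ℤ.^ n)

rhs : ℕ → ℕ → ℤ
rhs m n =
  sumℤ (map (λ n₁ →
    sumℤ (map (λ m₁ → term m n n₁ m₁ (m ∸ n₁ ∸ m₁))
              (upTo (suc (m ∸ n₁)))))
       (upTo (suc m)))

module Submission where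

-- (R , S) is a proper merging iff both composites R ⨾ S and S ⨾ R are empty: a R b S a′ forces
-- a = a′ by transitivity inside the antichain, and a R b S a contradicts properness. So no point of
-- A₁ may lie in dom R ∩ ran S and no point of A₂ in ran R ∩ dom S. Choose (R , S) one point b of A₂
-- at a time, as a column c of R and a row r of S: c and r must not both be nonempty, and the
-- accumulated dom R and ran S must end up disjoint. Expanding [¬(p ∧ q)] = [¬q] + [¬p] − [¬p ∧ ¬q]
-- at every point of A₁ labels A₁ with three labels; for a labelling with i, j, k points of each label
-- the points of A₂ become independent, each admitting 2^i + 2^j − 1 choices of (c , r), and the
-- labelling carries the sign (−1)^k. Grouping the labellings by (i , j , k) gives the multinomials.

open import Defs
open import Algebra.Bundles using (CommutativeMonoid)
import Algebra.Properties.CommutativeSemigroup as CommutativeSemigroupProperties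
open import Data.Bool using (Bool; true; false; _∧_; _∨_; not; if_then_else_)
import Data.Bool.Properties as Bool
open import Data.Empty using (⊥; ⊥-elim)
open import Data.Fin using (zero; suc)
open import Data.Integer as ℤ using (ℤ; +_; -_; _+_; _*_; _-_)
import Data.Integer.Properties as ℤ
open import Data.Integer.Tactic.RingSolver using (solve-∀)
open import Data.List as List using (List; []; _∷_; _++_; map; length; upTo; filterᵇ; cartesianProductWith; cartesianProduct)
import Data.List.Properties as List
open import Data.List.Membership.Propositional using (_∈_)
open import Data.List.Membership.Propositional.Properties using (∈-upTo⁻; ∈-cartesianProductWith⁺; ∈-cartesianProduct⁺; ∈-filter⁺; ∈-filter⁻)
open import Data.List.Relation.Unary.Any using (here; there)
open import Data.List.Relation.Unary.All using (All)
open import Data.List.Relation.Unary.AllPairs using (AllPairs)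
open import Data.List.Relation.Unary.Unique.Propositional using (Unique)
import Data.List.Relation.Unary.Unique.Propositional.Properties as Unique
open import Data.Nat as ℕ using (ℕ; zero; suc; _∸_; _≤_; _!)
import Data.Nat.Properties as ℕ
open import Data.Nat.Combinatorics using (_C_; nCk+nC[k+1]≡[n+1]C[k+1]; k>n⇒nCk≡0; nCk≡n!/k![n-k]!; k![n∸k]!∣n!)
open import Data.Nat.DivMod using (m*n/n≡m; m/n*n≡m)
open import Data.Nat.Properties using (_!≢0; _!*_!≢0)
import Data.Nat.Tactic.RingSolver as ℕSolver
open import Data.Product using (Σ; ∃-syntax; _×_; _,_; proj₁; proj₂)
open import Data.Product.Properties using (,-injectiveˡ; ,-injectiveʳ)
open import Data.Vec as Vec using (Vec; []; _∷_; lookup; replicate; zipWith)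
import Data.Vec.Properties as Vec
open import Function using (_∘_)
open import Function.Bundles using (_⇔_; mk⇔; Equivalence)
import Function.Properties.Equivalence as ⇔
open import Data.Product.Function.NonDependent.Propositional using (_×-⇔_)
open import Data.Sum using (inj₁; inj₂)
open import Relation.Binary.PropositionalEquality
open import Relation.Nullary using (contradiction; T?)

private variable A B : Set

∑ : List A → (A → ℤ) → ℤ
∑ xs f = sumℤ (map f xs)

∑-cong : ∀ (xs : List A) {f g : A → ℤ} → (∀ x → f x ≡ g x) → ∑ xs f ≡ ∑ xs g
∑-cong []       f≗g = refl
∑-cong (x ∷ xs) f≗g = cong₂ _+_ (f≗g x) (∑-cong xs f≗g)

∑-cong-∈ : ∀ (xs : List A) {f g : A → ℤ} → (∀ {x} → x ∈ xs → f x ≡ g x) → ∑ xs f ≡ ∑ xs g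
∑-cong-∈ []       f≗g = refl
∑-cong-∈ (x ∷ xs) f≗g = cong₂ _+_ (f≗g (here refl)) (∑-cong-∈ xs (f≗g ∘ there))

∑-++ : ∀ (xs ys : List A) f → ∑ (xs ++ ys) f ≡ ∑ xs f + ∑ ys f
∑-++ []       ys f = sym (ℤ.+-identityˡ _)
∑-++ (x ∷ xs) ys f = trans (cong (_+_ (f x)) (∑-++ xs ys f)) (sym (ℤ.+-assoc (f x) _ _))

∑-+ : ∀ (xs : List A) f g → ∑ xs (λ x → f x + g x) ≡ ∑ xs f + ∑ xs g
∑-+ []       f g = refl
∑-+ (x ∷ xs) f g = trans (cong (_+_ (f x + g x)) (∑-+ xs f g)) (interchange (f x) (g x) (∑ xs f) (∑ xs g))
  where interchange : ∀ a b c d → (a + b) + (c + d) ≡ (a + c) + (b + d)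
        interchange = solve-∀

∑-- : ∀ (xs : List A) f g → ∑ xs (λ x → f x - g x) ≡ ∑ xs f - ∑ xs g
∑-- []       f g = refl
∑-- (x ∷ xs) f g = trans (cong (_+_ (f x - g x)) (∑-- xs f g)) (interchange (f x) (g x) (∑ xs f) (∑ xs g))
  where interchange : ∀ a b c d → (a - b) + (c - d) ≡ (a + c) - (b + d)
        interchange = solve-∀

∑-*ˡ : ∀ (xs : List A) k f → ∑ xs (λ x → k * f x) ≡ k * ∑ xs f
∑-*ˡ []       k f = sym (ℤ.*-zeroʳ k)
∑-*ˡ (x ∷ xs) k f = trans (cong (_+_ (k * f x)) (∑-*ˡ xs k f)) (sym (ℤ.*-distribˡ-+ k _ _))

∑-zero : ∀ (xs : List A) → ∑ xs (λ _ → + 0) ≡ + 0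
∑-zero []       = refl
∑-zero (x ∷ xs) = trans (ℤ.+-identityˡ _) (∑-zero xs)

∑-*ʳ : ∀ (xs : List A) f k → ∑ xs (λ x → f x * k) ≡ ∑ xs f * k
∑-*ʳ xs f k = begin
  ∑ xs (λ x → f x * k) ≡⟨ ∑-cong xs (λ x → ℤ.*-comm (f x) k) ⟩
  ∑ xs (λ x → k * f x) ≡⟨ ∑-*ˡ xs k f ⟩
  k * ∑ xs f           ≡⟨ ℤ.*-comm k _ ⟩
  ∑ xs f * k           ∎
  where open ≡-Reasoning

∑-map : ∀ (g : A → B) (xs : List A) f → ∑ (map g xs) f ≡ ∑ xs (f ∘ g)
∑-map g xs f = cong sumℤ (sym (List.map-∘ xs))

∑-swap : ∀ (xs : List A) (ys : List B) (f : A → B → ℤ) →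
         ∑ xs (λ x → ∑ ys (f x)) ≡ ∑ ys (λ y → ∑ xs (λ x → f x y))
∑-swap []       ys f = sym (∑-zero ys)
∑-swap (x ∷ xs) ys f = trans (cong (_+_ (∑ ys (f x))) (∑-swap xs ys f)) (sym (∑-+ ys (f x) _))

∑-product : ∀ (xs : List A) (ys : List B) f g →
            ∑ xs (λ x → ∑ ys (λ y → f x * g y)) ≡ ∑ xs f * ∑ ys g
∑-product xs ys f g = trans (∑-cong xs (λ x → ∑-*ˡ ys (f x) g)) (∑-*ʳ xs f (∑ ys g))

∑-cartesianProductWith : ∀ {D : Set} (_⊕_ : A → B → D) xs ys f →
  ∑ (cartesianProductWith _⊕_ xs ys) f ≡ ∑ xs (λ x → ∑ ys (λ y → f (x ⊕ y)))
∑-cartesianProductWith _⊕_ []       ys f = refl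
∑-cartesianProductWith _⊕_ (x ∷ xs) ys f = begin
  ∑ (map (x ⊕_) ys ++ cartesianProductWith _⊕_ xs ys) f
    ≡⟨ ∑-++ (map (x ⊕_) ys) _ f ⟩
  ∑ (map (x ⊕_) ys) f + ∑ (cartesianProductWith _⊕_ xs ys) f
    ≡⟨ cong₂ _+_ (∑-map (x ⊕_) ys f) (∑-cartesianProductWith _⊕_ xs ys f) ⟩
  ∑ ys (λ y → f (x ⊕ y)) + ∑ xs (λ x → ∑ ys (λ y → f (x ⊕ y))) ∎
  where open ≡-Reasoning

∑-pull : ∀ {X Y Z : Set} (xs : List X) (ys : List Y) (zs : List Z) (g : X → Y → Z → ℤ) (h : Z → ℤ) →
  ∑ xs (λ x → ∑ ys (λ y → ∑ zs (λ z → g x y z * h z))) ≡ ∑ zs (λ z → ∑ xs (λ x → ∑ ys (λ y → g x y z)) * h z)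
∑-pull xs ys zs g h = begin
  ∑ xs (λ x → ∑ ys (λ y → ∑ zs (λ z → g x y z * h z)))
    ≡⟨ ∑-cong xs (λ x → ∑-swap ys zs (λ y z → g x y z * h z)) ⟩
  ∑ xs (λ x → ∑ zs (λ z → ∑ ys (λ y → g x y z * h z)))
    ≡⟨ ∑-swap xs zs (λ x z → ∑ ys (λ y → g x y z * h z)) ⟩
  ∑ zs (λ z → ∑ xs (λ x → ∑ ys (λ y → g x y z * h z)))
    ≡⟨ ∑-cong zs (λ z → trans (∑-cong xs (λ x → ∑-*ʳ ys (λ y → g x y z) (h z))) (∑-*ʳ xs _ (h z))) ⟩
  ∑ zs (λ z → ∑ xs (λ x → ∑ ys (λ y → g x y z)) * h z) ∎
  where open ≡-Reasoning

∑-upTo-suc : ∀ n (f : ℕ → ℤ) → ∑ (upTo (suc n)) f ≡ f 0 + ∑ (upTo n) (f ∘ suc)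
∑-upTo-suc n f = cong (_+_ (f 0)) (begin
  ∑ (List.applyUpTo suc n) f ≡⟨ cong (λ xs → ∑ xs f) (List.map-upTo suc n) ⟨
  ∑ (map suc (upTo n)) f     ≡⟨ ∑-map suc (upTo n) f ⟩
  ∑ (upTo n) (f ∘ suc)       ∎)
  where open ≡-Reasoning

∑-upTo-∷ʳ : ∀ n (f : ℕ → ℤ) → ∑ (upTo (suc n)) f ≡ ∑ (upTo n) f + f n
∑-upTo-∷ʳ n f = begin
  ∑ (upTo (suc n)) f          ≡⟨ cong (λ xs → ∑ xs f) (List.upTo-∷ʳ n) ⟨
  ∑ (upTo n ++ n ∷ []) f      ≡⟨ ∑-++ (upTo n) (n ∷ []) f ⟩
  ∑ (upTo n) f + (f n + + 0)  ≡⟨ cong (_+_ (∑ (upTo n) f)) (ℤ.+-identityʳ (f n)) ⟩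
  ∑ (upTo n) f + f n          ∎
  where open ≡-Reasoning

⟦_⟧ : Bool → ℤ
⟦ true  ⟧ = + 1
⟦ false ⟧ = + 0

⟦∧⟧ : ∀ a b → ⟦ a ∧ b ⟧ ≡ ⟦ a ⟧ * ⟦ b ⟧
⟦∧⟧ true  b = sym (ℤ.*-identityˡ ⟦ b ⟧)
⟦∧⟧ false b = refl

length-filterᵇ : ∀ (p : A → Bool) xs → + length (filterᵇ p xs) ≡ ∑ xs (⟦_⟧ ∘ p)
length-filterᵇ p []       = refl
length-filterᵇ p (x ∷ xs) with p x
... | true  = trans (ℤ.pos-+ 1 _) (cong (_+_ (+ 1)) (length-filterᵇ p xs))
... | false = trans (length-filterᵇ p xs) (sym (ℤ.+-identityˡ _))

vecs : List A → (k : ℕ) → List (Vec A k)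
vecs xs zero    = [] ∷ []
vecs xs (suc k) = cartesianProductWith _∷_ xs (vecs xs k)

vecs-unique : ∀ {xs : List A} k → Unique xs → Unique (vecs xs k)
vecs-unique zero    _   = All.[] AllPairs.∷ AllPairs.[]
vecs-unique (suc k) xs-unique = Unique.cartesianProductWith⁺ _∷_ Vec.∷-injective xs-unique (vecs-unique k xs-unique)

∈-vecs : ∀ {xs : List A} → (∀ x → x ∈ xs) → ∀ {k} (v : Vec A k) → v ∈ vecs xs k
∈-vecs all∈ []      = here refl
∈-vecs all∈ (x ∷ v) = ∈-cartesianProductWith⁺ _∷_ (all∈ x) (∈-vecs all∈ v)

∑-vecs-∷ : ∀ (xs : List A) k {f : Vec A (suc k) → ℤ} (g : A → ℤ) (h : Vec A k → ℤ) →
           (∀ x v → f (x ∷ v) ≡ g x * h v) → ∑ (vecs xs (suc k)) f ≡ ∑ xs g * ∑ (vecs xs k) h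
∑-vecs-∷ xs k {f} g h split = begin
  ∑ (vecs xs (suc k)) f                         ≡⟨ ∑-cartesianProductWith _∷_ xs (vecs xs k) f ⟩
  ∑ xs (λ x → ∑ (vecs xs k) (λ v → f (x ∷ v)))  ≡⟨ ∑-cong xs (λ x → ∑-cong (vecs xs k) (split x)) ⟩
  ∑ xs (λ x → ∑ (vecs xs k) (λ v → g x * h v))  ≡⟨ ∑-product xs (vecs xs k) g h ⟩
  ∑ xs g * ∑ (vecs xs k) h                      ∎
  where open ≡-Reasoning

booleans : List Bool
booleans = true ∷ false ∷ []

booleans-unique : Unique booleans
booleans-unique = ((λ ()) All.∷ All.[]) AllPairs.∷ (All.[] AllPairs.∷ AllPairs.[])

∈-booleans : ∀ b → b ∈ booleans
∈-booleans true  = here refl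
∈-booleans false = there (here refl)

-- Binomial and multinomial sums

-- pascalSum k h is the sum of h (#a w) (#b w) over all words w of length k in two letters a, b.
pascalSum : ℕ → (ℕ → ℕ → ℤ) → ℤ
pascalSum zero    h = h 0 0
pascalSum (suc k) h = pascalSum k (λ i j → h (suc i) j) + pascalSum k (λ i j → h i (suc j))

pascalSum-+ : ∀ k g h → pascalSum k (λ i j → g i j + h i j) ≡ pascalSum k g + pascalSum k h
pascalSum-+ zero    g h = refl
pascalSum-+ (suc k) g h =
  trans (cong₂ _+_ (pascalSum-+ k (λ i j → g (suc i) j) (λ i j → h (suc i) j))
                   (pascalSum-+ k (λ i j → g i (suc j)) (λ i j → h i (suc j))))
        (interchange (pascalSum k (λ i j → g (suc i) j)) (pascalSum k (λ i j → h (suc i) j))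
                     (pascalSum k (λ i j → g i (suc j))) (pascalSum k (λ i j → h i (suc j))))
  where interchange : ∀ a b c d → (a + b) + (c + d) ≡ (a + c) + (b + d)
        interchange = solve-∀

∑-binomial-shift : ∀ k (h : ℕ → ℕ → ℤ) →
  ∑ (upTo (suc k)) (λ i → + (k C i) * h i (suc (k ∸ i))) ≡
  h 0 (suc k) + ∑ (upTo (suc k)) (λ i → + (k C suc i) * h (suc i) (k ∸ i))
∑-binomial-shift k h = begin
  ∑ (upTo (suc k)) (λ i → + (k C i) * h i (suc (k ∸ i)))
    ≡⟨ ∑-upTo-suc k (λ i → + (k C i) * h i (suc (k ∸ i))) ⟩
  + 1 * h 0 (suc k) + ∑ (upTo k) (λ i → + (k C suc i) * h (suc i) (suc (k ∸ suc i)))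
    ≡⟨ cong₂ _+_ (ℤ.*-identityˡ (h 0 (suc k))) (∑-cong-∈ (upTo k) λ {i} i∈ →
         cong (λ r → + (k C suc i) * h (suc i) r) (sym (ℕ.+-∸-assoc 1 (∈-upTo⁻ i∈)))) ⟩
  h 0 (suc k) + ∑ (upTo k) g
    ≡⟨ cong (_+_ (h 0 (suc k))) (sym (trans (cong (_+_ (∑ (upTo k) g)) last≡0) (ℤ.+-identityʳ _))) ⟩
  h 0 (suc k) + (∑ (upTo k) g + g k)
    ≡⟨ cong (_+_ (h 0 (suc k))) (∑-upTo-∷ʳ k g) ⟨
  h 0 (suc k) + ∑ (upTo (suc k)) g ∎
  where
  open ≡-Reasoning
  g : ℕ → ℤ
  g i = + (k C suc i) * h (suc i) (k ∸ i)
  last≡0 : g k ≡ + 0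
  last≡0 = trans (cong (λ c → + c * h (suc k) (k ∸ k)) (k>n⇒nCk≡0 (ℕ.n<1+n k))) (ℤ.*-zeroˡ (h (suc k) (k ∸ k)))

pascalSum-binomial : ∀ k h → pascalSum k h ≡ ∑ (upTo (suc k)) (λ i → + (k C i) * h i (k ∸ i))
pascalSum-binomial zero    h = sym (trans (ℤ.+-identityʳ _) (ℤ.*-identityˡ (h 0 0)))
pascalSum-binomial (suc k) h = begin
  pascalSum k (λ i j → h (suc i) j) + pascalSum k (λ i j → h i (suc j))
    ≡⟨ cong₂ _+_ (pascalSum-binomial k (λ i j → h (suc i) j)) (pascalSum-binomial k (λ i j → h i (suc j))) ⟩
  ∑ (upTo (suc k)) f + ∑ (upTo (suc k)) (λ i → + (k C i) * h i (suc (k ∸ i)))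
    ≡⟨ cong (_+_ (∑ (upTo (suc k)) f)) (∑-binomial-shift k h) ⟩
  ∑ (upTo (suc k)) f + (h 0 (suc k) + ∑ (upTo (suc k)) g)
    ≡⟨ swap (∑ (upTo (suc k)) f) (h 0 (suc k)) _ ⟩
  h 0 (suc k) + (∑ (upTo (suc k)) f + ∑ (upTo (suc k)) g)
    ≡⟨ cong (_+_ (h 0 (suc k))) (∑-+ (upTo (suc k)) f g) ⟨
  h 0 (suc k) + ∑ (upTo (suc k)) (λ i → f i + g i)
    ≡⟨ cong (_+_ (h 0 (suc k))) (∑-cong (upTo (suc k)) pascal) ⟩
  h 0 (suc k) + ∑ (upTo (suc k)) (λ i → + (suc k C suc i) * h (suc i) (k ∸ i))
    ≡⟨ cong (_+ ∑ (upTo (suc k)) (λ i → + (suc k C suc i) * h (suc i) (k ∸ i))) (ℤ.*-identityˡ (h 0 (suc k))) ⟨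
  + 1 * h 0 (suc k) + ∑ (upTo (suc k)) (λ i → + (suc k C suc i) * h (suc i) (k ∸ i))
    ≡⟨ ∑-upTo-suc (suc k) (λ i → + (suc k C i) * h i (suc k ∸ i)) ⟨
  ∑ (upTo (suc (suc k))) (λ i → + (suc k C i) * h i (suc k ∸ i)) ∎
  where
  open ≡-Reasoning
  f g : ℕ → ℤ
  f i = + (k C i) * h (suc i) (k ∸ i)
  g i = + (k C suc i) * h (suc i) (k ∸ i)
  swap : ∀ a b c → a + (b + c) ≡ b + (a + c)
  swap = solve-∀
  pascal : ∀ i → f i + g i ≡ + (suc k C suc i) * h (suc i) (k ∸ i)
  pascal i = begin
    + (k C i) * h (suc i) (k ∸ i) + + (k C suc i) * h (suc i) (k ∸ i)
      ≡⟨ ℤ.*-distribʳ-+ (h (suc i) (k ∸ i)) (+ (k C i)) (+ (k C suc i)) ⟨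
    (+ (k C i) + + (k C suc i)) * h (suc i) (k ∸ i)
      ≡⟨ cong (_* h (suc i) (k ∸ i)) (trans (sym (ℤ.pos-+ (k C i) (k C suc i))) (cong +_ (nCk+nC[k+1]≡[n+1]C[k+1] k i))) ⟩
    + (suc k C suc i) * h (suc i) (k ∸ i) ∎

nCk*k![n∸k]!≡n! : ∀ {n k} → k ≤ n → (n C k) ℕ.* (k ! ℕ.* (n ∸ k) !) ≡ n !
nCk*k![n∸k]!≡n! {n} {k} k≤n =
  trans (cong (ℕ._* (k ! ℕ.* (n ∸ k) !)) (nCk≡n!/k![n-k]! k≤n))
        (m/n*n≡m {{k !* (n ∸ k) !≢0}} (k![n∸k]!∣n! k≤n))

multinomial≡CC : ∀ {m i j} → i ≤ m → j ≤ m ∸ i →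
                 multinomial m i j (m ∸ i ∸ j) ≡ (m C i) ℕ.* ((m ∸ i) C j)
multinomial≡CC {m} {i} {j} i≤m j≤m∸i =
  trans (cong (λ x → (x ℕ./ D) {{D≢0}}) m!≡) (m*n/n≡m ((m C i) ℕ.* ((m ∸ i) C j)) D {{D≢0}})
  where
  D : ℕ
  D = (i ! ℕ.* j !) ℕ.* (m ∸ i ∸ j) !
  D≢0 : ℕ.NonZero D
  D≢0 = ℕ.m*n≢0 _ _ {{ℕ.m*n≢0 _ _ {{i !≢0}} {{j !≢0}}}} {{(m ∸ i ∸ j) !≢0}}
  regroup : ∀ a b x y z → a ℕ.* (x ℕ.* (b ℕ.* (y ℕ.* z))) ≡ (a ℕ.* b) ℕ.* ((x ℕ.* y) ℕ.* z)
  regroup = ℕSolver.solve-∀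
  m!≡ : m ! ≡ ((m C i) ℕ.* ((m ∸ i) C j)) ℕ.* D
  m!≡ = begin
    m !                                                   ≡⟨ nCk*k![n∸k]!≡n! i≤m ⟨
    (m C i) ℕ.* (i ! ℕ.* (m ∸ i) !)                       ≡⟨ cong (λ x → (m C i) ℕ.* (i ! ℕ.* x)) (nCk*k![n∸k]!≡n! j≤m∸i) ⟨
    (m C i) ℕ.* (i ! ℕ.* (((m ∸ i) C j) ℕ.* (j ! ℕ.* (m ∸ i ∸ j) !)))
                                                          ≡⟨ regroup (m C i) ((m ∸ i) C j) (i !) (j !) ((m ∸ i ∸ j) !) ⟩
    ((m C i) ℕ.* ((m ∸ i) C j)) ℕ.* D                     ∎
    where open ≡-Reasoning

summand : ℕ → ℕ → ℕ → ℕ → ℤ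
summand n i j k = (- + 1) ℤ.^ k * ((+ (2 ℕ.^ i) + + (2 ℕ.^ j) - + 1) ℤ.^ n)

rhs≡pascalSum : ∀ m n → rhs m n ≡ pascalSum m (λ i r → pascalSum r (summand n i))
rhs≡pascalSum m n = begin
  ∑ (upTo (suc m)) (λ i → ∑ (upTo (suc (m ∸ i))) (λ j → term m n i j (m ∸ i ∸ j)))
    ≡⟨ ∑-cong-∈ (upTo (suc m)) (λ i∈ → inner (ℕ.s≤s⁻¹ (∈-upTo⁻ i∈))) ⟩
  ∑ (upTo (suc m)) (λ i → + (m C i) * pascalSum (m ∸ i) (summand n i))
    ≡⟨ pascalSum-binomial m (λ i r → pascalSum r (summand n i)) ⟨
  pascalSum m (λ i r → pascalSum r (summand n i)) ∎
  where
  open ≡-Reasoning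
  reassoc : ∀ a b s c → a * b * s * c ≡ a * (b * (s * c))
  reassoc = solve-∀
  factor : ∀ {i j} → i ≤ m → j ≤ m ∸ i →
           term m n i j (m ∸ i ∸ j) ≡ + (m C i) * (+ ((m ∸ i) C j) * summand n i j (m ∸ i ∸ j))
  factor {i} {j} i≤m j≤m∸i =
    trans (cong (λ x → x * (- + 1) ℤ.^ (m ∸ i ∸ j) * ((+ (2 ℕ.^ i) + + (2 ℕ.^ j) - + 1) ℤ.^ n))
                (trans (cong +_ (multinomial≡CC i≤m j≤m∸i)) (ℤ.pos-* (m C i) ((m ∸ i) C j))))
          (reassoc (+ (m C i)) (+ ((m ∸ i) C j)) ((- + 1) ℤ.^ (m ∸ i ∸ j)) ((+ (2 ℕ.^ i) + + (2 ℕ.^ j) - + 1) ℤ.^ n))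
  inner : ∀ {i} → i ≤ m →
          ∑ (upTo (suc (m ∸ i))) (λ j → term m n i j (m ∸ i ∸ j)) ≡ + (m C i) * pascalSum (m ∸ i) (summand n i)
  inner {i} i≤m = begin
    ∑ (upTo (suc (m ∸ i))) (λ j → term m n i j (m ∸ i ∸ j))
      ≡⟨ ∑-cong-∈ (upTo (suc (m ∸ i))) (λ j∈ → factor i≤m (ℕ.s≤s⁻¹ (∈-upTo⁻ j∈))) ⟩
    ∑ (upTo (suc (m ∸ i))) (λ j → + (m C i) * (+ ((m ∸ i) C j) * summand n i j (m ∸ i ∸ j)))
      ≡⟨ ∑-*ˡ (upTo (suc (m ∸ i))) (+ (m C i)) _ ⟩
    + (m C i) * ∑ (upTo (suc (m ∸ i))) (λ j → + ((m ∸ i) C j) * summand n i j (m ∸ i ∸ j))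
      ≡⟨ cong (_*_ (+ (m C i))) (pascalSum-binomial (m ∸ i) (summand n i)) ⟨
    + (m C i) * pascalSum (m ∸ i) (summand n i) ∎

-- Inclusion–exclusion over labellings

-- A labelling chooses, at each coordinate, one of the three terms of
-- [¬(p ∧ q)] = [¬q] + [¬p] − [¬p ∧ ¬q]: free₁ leaves p free, free₂ leaves q free, none frees neither.
data Label : Set where
  free₁ free₂ none : Label

labels : List Label
labels = free₁ ∷ free₂ ∷ none ∷ []

_==_ : Label → Label → Bool
free₁ == free₁ = true
free₂ == free₂ = true
none  == none  = true
_     == _     = false

occurrences : ∀ {k} → Label → Vec Label k → ℕ
occurrences T []      = 0
occurrences T (L ∷ ℓ) = if L == T then suc (occurrences T ℓ) else occurrences T ℓ

∑-labellings : ∀ k (F : ℕ → ℕ → ℕ → ℤ) →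
  ∑ (vecs labels k) (λ ℓ → F (occurrences free₁ ℓ) (occurrences free₂ ℓ) (occurrences none ℓ))
    ≡ pascalSum k (λ i r → pascalSum r (F i))
∑-labellings zero    F = ℤ.+-identityʳ _
∑-labellings (suc k) F = begin
  ∑ (vecs labels (suc k)) (count F)
    ≡⟨ ∑-cartesianProductWith _∷_ labels (vecs labels k) (count F) ⟩
  ∑ (vecs labels k) (count (λ i j l → F (suc i) j l))
    + (∑ (vecs labels k) (count (λ i j l → F i (suc j) l))
       + (∑ (vecs labels k) (count (λ i j l → F i j (suc l))) + + 0))
    ≡⟨ cong₂ _+_ (∑-labellings k (λ i j l → F (suc i) j l))
                 (cong₂ _+_ (∑-labellings k (λ i j l → F i (suc j) l))
                            (trans (ℤ.+-identityʳ _) (∑-labellings k (λ i j l → F i j (suc l))))) ⟩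
  pascalSum k (λ i r → pascalSum r (F (suc i)))
    + (pascalSum k (λ i r → pascalSum r (λ j l → F i (suc j) l))
       + pascalSum k (λ i r → pascalSum r (λ j l → F i j (suc l))))
    ≡⟨ cong (_+_ (pascalSum k (λ i r → pascalSum r (F (suc i)))))
            (pascalSum-+ k (λ i r → pascalSum r (λ j l → F i (suc j) l)) (λ i r → pascalSum r (λ j l → F i j (suc l)))) ⟨
  pascalSum (suc k) (λ i r → pascalSum r (F i)) ∎
  where
  open ≡-Reasoning
  count : (ℕ → ℕ → ℕ → ℤ) → ∀ {k} → Vec Label k → ℤ
  count G ℓ = G (occurrences free₁ ℓ) (occurrences free₂ ℓ) (occurrences none ℓ)

module ∧ = CommutativeSemigroupProperties (CommutativeMonoid.commutativeSemigroup Bool.∧-commutativeMonoid)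

any : ∀ {k} → Vec Bool k → Bool
any []      = false
any (b ∷ u) = b ∨ any u

_∨v_ : ∀ {k} → Vec Bool k → Vec Bool k → Vec Bool k
_∨v_ = zipWith _∨_

disjoint : ∀ {k} → Vec Bool k → Vec Bool k → Bool
disjoint []      []      = true
disjoint (x ∷ u) (y ∷ v) = not (x ∧ y) ∧ disjoint u v

supportedOn : ∀ {k} → Label → Vec Label k → Vec Bool k → Bool
supportedOn T []      []      = true
supportedOn T (L ∷ ℓ) (b ∷ u) = (not b ∨ L == T) ∧ supportedOn T ℓ u

admits : ∀ {k} → Vec Label k → Vec Bool k → Vec Bool k → Bool
admits ℓ u v = supportedOn free₁ ℓ u ∧ supportedOn free₂ ℓ v

admitsAt : Label → Bool → Bool → Bool
admitsAt L x y = (not x ∨ L == free₁) ∧ (not y ∨ L == free₂)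

admits-∷ : ∀ {k} L (ℓ : Vec Label k) x u y v →
           admits (L ∷ ℓ) (x ∷ u) (y ∷ v) ≡ admitsAt L x y ∧ admits ℓ u v
admits-∷ L ℓ x u y v = ∧.interchange (not x ∨ L == free₁) (supportedOn free₁ ℓ u) (not y ∨ L == free₂) (supportedOn free₂ ℓ v)

sign : ∀ {k} → Vec Label k → ℤ
sign ℓ = (- + 1) ℤ.^ occurrences none ℓ

sign-∷ : ∀ {k} L (ℓ : Vec Label k) → sign (L ∷ ℓ) ≡ sign (L ∷ []) * sign ℓ
sign-∷ free₁ ℓ = sym (ℤ.*-identityˡ (sign ℓ))
sign-∷ free₂ ℓ = sym (ℤ.*-identityˡ (sign ℓ))
sign-∷ none  ℓ = refl

disjoint-inclusion-exclusion : ∀ {k} (u v : Vec Bool k) →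
  ⟦ disjoint u v ⟧ ≡ ∑ (vecs labels k) (λ ℓ → ⟦ admits ℓ u v ⟧ * sign ℓ)
disjoint-inclusion-exclusion []      []      = refl
disjoint-inclusion-exclusion (x ∷ u) (y ∷ v) = begin
  ⟦ not (x ∧ y) ∧ disjoint u v ⟧
    ≡⟨ ⟦∧⟧ (not (x ∧ y)) (disjoint u v) ⟩
  ⟦ not (x ∧ y) ⟧ * ⟦ disjoint u v ⟧
    ≡⟨ cong₂ _*_ (coordinate x y) (disjoint-inclusion-exclusion u v) ⟩
  ∑ labels (λ L → ⟦ admitsAt L x y ⟧ * sign (L ∷ [])) * ∑ (vecs labels _) (λ ℓ → ⟦ admits ℓ u v ⟧ * sign ℓ)
    ≡⟨ ∑-vecs-∷ labels _ (λ L → ⟦ admitsAt L x y ⟧ * sign (L ∷ [])) (λ ℓ → ⟦ admits ℓ u v ⟧ * sign ℓ) split ⟨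
  ∑ (vecs labels _) (λ ℓ → ⟦ admits ℓ (x ∷ u) (y ∷ v) ⟧ * sign ℓ) ∎
  where
  open ≡-Reasoning
  coordinate : ∀ x y → ⟦ not (x ∧ y) ⟧ ≡ ∑ labels (λ L → ⟦ admitsAt L x y ⟧ * sign (L ∷ []))
  coordinate true  true  = refl
  coordinate true  false = refl
  coordinate false true  = refl
  coordinate false false = refl
  regroup : ∀ a b s t → (a * b) * (s * t) ≡ (a * s) * (b * t)
  regroup = solve-∀
  split : ∀ L ℓ → ⟦ admits (L ∷ ℓ) (x ∷ u) (y ∷ v) ⟧ * sign (L ∷ ℓ)
                ≡ (⟦ admitsAt L x y ⟧ * sign (L ∷ [])) * (⟦ admits ℓ u v ⟧ * sign ℓ)
  split L ℓ = begin
    ⟦ admits (L ∷ ℓ) (x ∷ u) (y ∷ v) ⟧ * sign (L ∷ ℓ)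
      ≡⟨ cong₂ (λ b s → ⟦ b ⟧ * s) (admits-∷ L ℓ x u y v) (sign-∷ L ℓ) ⟩
    ⟦ admitsAt L x y ∧ admits ℓ u v ⟧ * (sign (L ∷ []) * sign ℓ)
      ≡⟨ cong (_* (sign (L ∷ []) * sign ℓ)) (⟦∧⟧ (admitsAt L x y) (admits ℓ u v)) ⟩
    ⟦ admitsAt L x y ⟧ * ⟦ admits ℓ u v ⟧ * (sign (L ∷ []) * sign ℓ)
      ≡⟨ regroup ⟦ admitsAt L x y ⟧ ⟦ admits ℓ u v ⟧ (sign (L ∷ [])) (sign ℓ) ⟩
    (⟦ admitsAt L x y ⟧ * sign (L ∷ [])) * (⟦ admits ℓ u v ⟧ * sign ℓ) ∎

∑-supportedOn : ∀ {k} T (ℓ : Vec Label k) →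
  ∑ (vecs booleans k) (λ u → ⟦ supportedOn T ℓ u ⟧) ≡ + (2 ℕ.^ occurrences T ℓ)
∑-supportedOn T []      = refl
∑-supportedOn T (L ∷ ℓ) =
  trans (∑-vecs-∷ booleans _ (λ b → ⟦ not b ∨ L == T ⟧) (λ u → ⟦ supportedOn T ℓ u ⟧) (λ b u → ⟦∧⟧ (not b ∨ L == T) _))
        (trans (cong (_*_ (∑ booleans (λ b → ⟦ not b ∨ L == T ⟧))) (∑-supportedOn T ℓ)) (doubling (L == T) (occurrences T ℓ)))
  where
  doubling : ∀ e o → ∑ booleans (λ b → ⟦ not b ∨ e ⟧) * + (2 ℕ.^ o) ≡ + (2 ℕ.^ (if e then suc o else o))
  doubling true  o = sym (ℤ.pos-* 2 (2 ℕ.^ o))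
  doubling false o = ℤ.*-identityˡ _

∑-supportedOn-empty : ∀ {k} T (ℓ : Vec Label k) →
  ∑ (vecs booleans k) (λ u → ⟦ not (any u) ∧ supportedOn T ℓ u ⟧) ≡ + 1
∑-supportedOn-empty T []      = refl
∑-supportedOn-empty T (L ∷ ℓ) =
  trans (∑-vecs-∷ booleans _ (λ b → ⟦ not b ∧ (not b ∨ L == T) ⟧) (λ u → ⟦ not (any u) ∧ supportedOn T ℓ u ⟧) split)
        (cong (_*_ (+ 1)) (∑-supportedOn-empty T ℓ))
  where
  split : ∀ b u → ⟦ not (b ∨ any u) ∧ ((not b ∨ L == T) ∧ supportedOn T ℓ u) ⟧
                ≡ ⟦ not b ∧ (not b ∨ L == T) ⟧ * ⟦ not (any u) ∧ supportedOn T ℓ u ⟧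
  split true  u = refl
  split false u = trans (cong ⟦_⟧ (∧.x∙yz≈y∙xz (not (any u)) true (supportedOn T ℓ u)))
                        (⟦∧⟧ true (not (any u) ∧ supportedOn T ℓ u))

∑-supportedOn-nonempty : ∀ {k} T (ℓ : Vec Label k) →
  ∑ (vecs booleans k) (λ u → ⟦ any u ∧ supportedOn T ℓ u ⟧) ≡ + (2 ℕ.^ occurrences T ℓ) - + 1
∑-supportedOn-nonempty {k} T ℓ = begin
  ∑ (vecs booleans k) (λ u → ⟦ any u ∧ supportedOn T ℓ u ⟧)
    ≡⟨ ∑-cong (vecs booleans k) (λ u → complement (any u) (supportedOn T ℓ u)) ⟩
  ∑ (vecs booleans k) (λ u → ⟦ supportedOn T ℓ u ⟧ - ⟦ not (any u) ∧ supportedOn T ℓ u ⟧)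
    ≡⟨ ∑-- (vecs booleans k) _ _ ⟩
  ∑ (vecs booleans k) (λ u → ⟦ supportedOn T ℓ u ⟧) - ∑ (vecs booleans k) (λ u → ⟦ not (any u) ∧ supportedOn T ℓ u ⟧)
    ≡⟨ cong₂ _-_ (∑-supportedOn T ℓ) (∑-supportedOn-empty T ℓ) ⟩
  + (2 ℕ.^ occurrences T ℓ) - + 1 ∎
  where
  open ≡-Reasoning
  complement : ∀ a s → ⟦ a ∧ s ⟧ ≡ ⟦ s ⟧ - ⟦ not a ∧ s ⟧
  complement true  s = sym (ℤ.+-identityʳ ⟦ s ⟧)
  complement false s = sym (ℤ.+-inverseʳ ⟦ s ⟧)

compatible : ∀ {k} → Vec Bool k → Vec Bool k → Bool
compatible c r = not (any c ∧ any r)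

∑-compatible : ∀ {k} (ℓ : Vec Label k) →
  ∑ (vecs booleans k) (λ c → ∑ (vecs booleans k) (λ r → ⟦ compatible c r ⟧ * ⟦ admits ℓ c r ⟧))
    ≡ + (2 ℕ.^ occurrences free₁ ℓ) + + (2 ℕ.^ occurrences free₂ ℓ) - + 1
∑-compatible {k} ℓ = begin
  ∑ 𝔹ᵏ (λ c → ∑ 𝔹ᵏ (λ r → ⟦ compatible c r ⟧ * ⟦ admits ℓ c r ⟧))
    ≡⟨ ∑-cong 𝔹ᵏ (λ c → trans (∑-cong 𝔹ᵏ (λ r → exclude (any c) (any r) (S₁ c) (S₂ r))) (∑-- 𝔹ᵏ _ _)) ⟩
  ∑ 𝔹ᵏ (λ c → ∑ 𝔹ᵏ (λ r → ⟦ S₁ c ⟧ * ⟦ S₂ r ⟧) - ∑ 𝔹ᵏ (λ r → ⟦ any c ∧ S₁ c ⟧ * ⟦ any r ∧ S₂ r ⟧))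
    ≡⟨ ∑-- 𝔹ᵏ _ _ ⟩
  ∑ 𝔹ᵏ (λ c → ∑ 𝔹ᵏ (λ r → ⟦ S₁ c ⟧ * ⟦ S₂ r ⟧))
    - ∑ 𝔹ᵏ (λ c → ∑ 𝔹ᵏ (λ r → ⟦ any c ∧ S₁ c ⟧ * ⟦ any r ∧ S₂ r ⟧))
    ≡⟨ cong₂ _-_ (∑-product 𝔹ᵏ 𝔹ᵏ _ _) (∑-product 𝔹ᵏ 𝔹ᵏ _ _) ⟩
  ∑ 𝔹ᵏ (λ c → ⟦ S₁ c ⟧) * ∑ 𝔹ᵏ (λ r → ⟦ S₂ r ⟧)
    - ∑ 𝔹ᵏ (λ c → ⟦ any c ∧ S₁ c ⟧) * ∑ 𝔹ᵏ (λ r → ⟦ any r ∧ S₂ r ⟧)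
    ≡⟨ cong₂ _-_ (cong₂ _*_ (∑-supportedOn free₁ ℓ) (∑-supportedOn free₂ ℓ))
                 (cong₂ _*_ (∑-supportedOn-nonempty free₁ ℓ) (∑-supportedOn-nonempty free₂ ℓ)) ⟩
  + (2 ℕ.^ occurrences free₁ ℓ) * + (2 ℕ.^ occurrences free₂ ℓ)
    - (+ (2 ℕ.^ occurrences free₁ ℓ) - + 1) * (+ (2 ℕ.^ occurrences free₂ ℓ) - + 1)
    ≡⟨ simplify (+ (2 ℕ.^ occurrences free₁ ℓ)) (+ (2 ℕ.^ occurrences free₂ ℓ)) ⟩
  + (2 ℕ.^ occurrences free₁ ℓ) + + (2 ℕ.^ occurrences free₂ ℓ) - + 1 ∎
  where
  open ≡-Reasoning
  𝔹ᵏ : List (Vec Bool k)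
  𝔹ᵏ = vecs booleans k
  S₁ S₂ : Vec Bool k → Bool
  S₁ = supportedOn free₁ ℓ
  S₂ = supportedOn free₂ ℓ
  simplify : ∀ a b → a * b - (a - + 1) * (b - + 1) ≡ a + b - + 1
  simplify = solve-∀
  exclude : ∀ p q A B → ⟦ not (p ∧ q) ⟧ * ⟦ A ∧ B ⟧ ≡ ⟦ A ⟧ * ⟦ B ⟧ - ⟦ p ∧ A ⟧ * ⟦ q ∧ B ⟧
  exclude p q A B = trans (cong (_*_ ⟦ not (p ∧ q) ⟧) (⟦∧⟧ A B)) (cases p q)
    where
    cases : ∀ p q → ⟦ not (p ∧ q) ⟧ * (⟦ A ⟧ * ⟦ B ⟧) ≡ ⟦ A ⟧ * ⟦ B ⟧ - ⟦ p ∧ A ⟧ * ⟦ q ∧ B ⟧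
    cases true  true  = lemma ⟦ A ⟧ ⟦ B ⟧
      where lemma : ∀ a b → + 0 * (a * b) ≡ a * b - a * b
            lemma = solve-∀
    cases true  false = lemma ⟦ A ⟧ ⟦ B ⟧
      where lemma : ∀ a b → + 1 * (a * b) ≡ a * b - a * + 0
            lemma = solve-∀
    cases false q     = lemma ⟦ A ⟧ ⟦ B ⟧ ⟦ q ∧ B ⟧
      where lemma : ∀ a b c → + 1 * (a * b) ≡ a * b - + 0 * c
            lemma = solve-∀

not-∨-∨ : ∀ x y e → not (x ∨ y) ∨ e ≡ (not x ∨ e) ∧ (not y ∨ e)
not-∨-∨ false y e     = refl
not-∨-∨ true  y false = refl
not-∨-∨ true  y true  = sym (Bool.∨-zeroʳ (not y))

supportedOn-∨ : ∀ {k} T (ℓ : Vec Label k) u c → supportedOn T ℓ (u ∨v c) ≡ supportedOn T ℓ u ∧ supportedOn T ℓ c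
supportedOn-∨ T []      []      []      = refl
supportedOn-∨ T (L ∷ ℓ) (x ∷ u) (y ∷ c) =
  trans (cong₂ _∧_ (not-∨-∨ x y (L == T)) (supportedOn-∨ T ℓ u c))
        (∧.interchange (not x ∨ L == T) (not y ∨ L == T) (supportedOn T ℓ u) (supportedOn T ℓ c))

admits-∨ : ∀ {k} (ℓ : Vec Label k) u v c r → admits ℓ (u ∨v c) (v ∨v r) ≡ admits ℓ u v ∧ admits ℓ c r
admits-∨ ℓ u v c r =
  trans (cong₂ _∧_ (supportedOn-∨ free₁ ℓ u c) (supportedOn-∨ free₂ ℓ v r))
        (∧.interchange (supportedOn free₁ ℓ u) (supportedOn free₁ ℓ c) (supportedOn free₂ ℓ v) (supportedOn free₂ ℓ r))

supportedOn-replicate : ∀ {k} T (ℓ : Vec Label k) → supportedOn T ℓ (replicate k false) ≡ true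
supportedOn-replicate T []      = refl
supportedOn-replicate T (L ∷ ℓ) = supportedOn-replicate T ℓ

-- Proper mergings as Boolean conditions

Pair : ℕ → ℕ → Set
Pair m n = Rel₁₂ m n × Rel₁₂ n m

dom : ∀ {m n} → Vec (Vec Bool n) m → Vec Bool m
dom = Vec.map any

ran : ∀ {m n} → Vec (Vec Bool n) m → Vec Bool n
ran []      = replicate _ false
ran (r ∷ R) = r ∨v ran R

ComposesToEmpty : ∀ {m n} → Rel₁₂ m n → Rel₁₂ n m → Set
ComposesToEmpty R S = ∀ {a b a′} → R ∋⟨ a , b ⟩ → S ∋⟨ b , a′ ⟩ → ⊥

isProperMerging⇔ : ∀ {m n} (R : Rel₁₂ m n) (S : Rel₁₂ n m) →
                   IsProperMerging R S ⇔ (ComposesToEmpty S R × ComposesToEmpty R S)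
isProperMerging⇔ R S = mk⇔ to from
  where
  to : IsProperMerging R S → ComposesToEmpty S R × ComposesToEmpty R S
  to ((_ , transitive) , proper) = S⨾R≐∅ , R⨾S≐∅
    where
    S⨾R≐∅ : ComposesToEmpty S R
    S⨾R≐∅ {b} {a} {b′} Sba Rab′ with refl ← transitive (inj₂ b) (inj₁ a) (inj₂ b′) Sba Rab′ = proper a b (Rab′ , Sba)
    R⨾S≐∅ : ComposesToEmpty R S
    R⨾S≐∅ {a} {b} {a′} Rab Sba′ with refl ← transitive (inj₁ a) (inj₂ b) (inj₁ a′) Rab Sba′ = proper a b (Rab , Sba′)
  from : ComposesToEmpty S R × ComposesToEmpty R S → IsProperMerging R S
  from (S⨾R≐∅ , R⨾S≐∅) = (reflexive , transitive) , λ a b (Rab , Sba) → R⨾S≐∅ Rab Sba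
    where
    reflexive : ∀ x → MergedRel R S x x
    reflexive (inj₁ a) = refl
    reflexive (inj₂ b) = refl
    transitive : ∀ x y z → MergedRel R S x y → MergedRel R S y z → MergedRel R S x z
    transitive (inj₁ a) (inj₁ _) z        refl q    = q
    transitive (inj₂ b) (inj₂ _) z        refl q    = q
    transitive (inj₁ a) (inj₂ b) (inj₁ a′) p    q    = ⊥-elim (R⨾S≐∅ p q)
    transitive (inj₁ a) (inj₂ b) (inj₂ _)  p    refl = p
    transitive (inj₂ b) (inj₁ a) (inj₁ _)  p    refl = p
    transitive (inj₂ b) (inj₁ a) (inj₂ b′) p    q    = ⊥-elim (S⨾R≐∅ p q)

any⇔ : ∀ {k} (u : Vec Bool k) → any u ≡ true ⇔ (∃[ i ] lookup u i ≡ true)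
any⇔ u = mk⇔ (to u) (λ (i , uᵢ) → from u i uᵢ)
  where
  to : ∀ {k} (u : Vec Bool k) → any u ≡ true → ∃[ i ] lookup u i ≡ true
  to (true  ∷ u) _ = zero , refl
  to (false ∷ u) e with i , uᵢ ← to u e = suc i , uᵢ
  from : ∀ {k} (u : Vec Bool k) i → lookup u i ≡ true → any u ≡ true
  from (x ∷ u) zero    refl = refl
  from (x ∷ u) (suc i) uᵢ   = trans (cong (x ∨_) (from u i uᵢ)) (Bool.∨-zeroʳ x)

lookup-dom⇔ : ∀ {m n} (R : Rel₁₂ m n) a → lookup (dom R) a ≡ true ⇔ (∃[ b ] R ∋⟨ a , b ⟩)
lookup-dom⇔ R a = subst (λ x → (x ≡ true) ⇔ (∃[ b ] R ∋⟨ a , b ⟩)) (sym (Vec.lookup-map a any R)) (any⇔ (lookup R a))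

lookup-ran⇔ : ∀ {m n} (R : Rel₁₂ m n) b → lookup (ran R) b ≡ true ⇔ (∃[ a ] R ∋⟨ a , b ⟩)
lookup-ran⇔ R b = mk⇔ (to R) (λ (a , Rab) → from R a Rab)
  where
  to : ∀ {m} (R : Rel₁₂ m _) → lookup (ran R) b ≡ true → ∃[ a ] R ∋⟨ a , b ⟩
  to []      e = contradiction (trans (sym e) (Vec.lookup-replicate b false)) λ ()
  to (r ∷ R) e with lookup r b in rᵦ | trans (sym (Vec.lookup-zipWith _∨_ b r (ran R))) e
  ... | true  | _  = zero , rᵦ
  ... | false | e′ with a , Rab ← to R e′ = suc a , Rab
  from : ∀ {m} (R : Rel₁₂ m _) a → R ∋⟨ a , b ⟩ → lookup (ran R) b ≡ true
  from (r ∷ R) zero    Rab = trans (Vec.lookup-zipWith _∨_ b r (ran R)) (cong (_∨ _) Rab)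
  from (r ∷ R) (suc a) Rab = trans (Vec.lookup-zipWith _∨_ b r (ran R))
                                   (trans (cong (lookup r b ∨_) (from R a Rab)) (Bool.∨-zeroʳ _))

disjoint⇔ : ∀ {k} (u v : Vec Bool k) → disjoint u v ≡ true ⇔ (∀ i → lookup u i ≡ true → lookup v i ≡ true → ⊥)
disjoint⇔ u v = mk⇔ (to u v) (from u v)
  where
  to : ∀ {k} (u v : Vec Bool k) → disjoint u v ≡ true → ∀ i → lookup u i ≡ true → lookup v i ≡ true → ⊥
  to (true ∷ u) (true ∷ v) () zero    refl refl
  to (x ∷ u)    (y ∷ v)    d  (suc i) uᵢ   vᵢ   = to u v (Bool.∧-conicalʳ (not (x ∧ y)) _ d) i uᵢ vᵢ
  from : ∀ {k} (u v : Vec Bool k) → (∀ i → lookup u i ≡ true → lookup v i ≡ true → ⊥) → disjoint u v ≡ true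
  from []         []         _ = refl
  from (true ∷ u)  (true ∷ v)  h = ⊥-elim (h zero refl refl)
  from (true ∷ u)  (false ∷ v) h = from u v (h ∘ suc)
  from (false ∷ u) (y ∷ v)     h = from u v (h ∘ suc)

disjoint-comm : ∀ {k} (u v : Vec Bool k) → disjoint u v ≡ disjoint v u
disjoint-comm []      []      = refl
disjoint-comm (x ∷ u) (y ∷ v) = cong₂ (λ a d → not a ∧ d) (Bool.∧-comm x y) (disjoint-comm u v)

composesToEmpty⇔ : ∀ {m n} (R : Rel₁₂ m n) (S : Rel₁₂ n m) → ComposesToEmpty R S ⇔ disjoint (ran R) (dom S) ≡ true
composesToEmpty⇔ R S = mk⇔ to from
  where
  to : ComposesToEmpty R S → disjoint (ran R) (dom S) ≡ true
  to R⨾S≐∅ = Equivalence.from (disjoint⇔ (ran R) (dom S)) λ b p q →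
    R⨾S≐∅ (proj₂ (Equivalence.to (lookup-ran⇔ R b) p)) (proj₂ (Equivalence.to (lookup-dom⇔ S b) q))
  from : disjoint (ran R) (dom S) ≡ true → ComposesToEmpty R S
  from d {a} {b} {a′} Rab Sba′ = Equivalence.to (disjoint⇔ (ran R) (dom S)) d b
    (Equivalence.from (lookup-ran⇔ R b) (a , Rab)) (Equivalence.from (lookup-dom⇔ S b) (a′ , Sba′))

∧≡true⇔ : ∀ a b → a ∧ b ≡ true ⇔ (a ≡ true × b ≡ true)
∧≡true⇔ a b = mk⇔ (λ e → Bool.∧-conicalˡ a b e , Bool.∧-conicalʳ a b e) (λ (p , q) → cong₂ _∧_ p q)

properᵇ : ∀ {m n} → Pair m n → Bool
properᵇ (R , S) = disjoint (dom R) (ran S) ∧ disjoint (ran R) (dom S)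

properᵇ⇔ : ∀ {m n} (R : Rel₁₂ m n) (S : Rel₁₂ n m) → properᵇ (R , S) ≡ true ⇔ IsProperMerging R S
properᵇ⇔ R S = ⇔.trans (∧≡true⇔ _ _)
                        (⇔.trans (S⨾R≐∅⇔ ×-⇔ ⇔.sym (composesToEmpty⇔ R S)) (⇔.sym (isProperMerging⇔ R S)))
  where
  S⨾R≐∅⇔ : disjoint (dom R) (ran S) ≡ true ⇔ ComposesToEmpty S R
  S⨾R≐∅⇔ = subst (λ d → (d ≡ true) ⇔ ComposesToEmpty S R) (disjoint-comm (ran S) (dom R)) (⇔.sym (composesToEmpty⇔ S R))

-- Enumerating pairs column by column

-- A column (c , r) at a new point of A₂ is its R-predecessor set c and its S-successor set r.
consColumn : ∀ {m n} → Vec Bool m × Vec Bool m → Pair m n → Pair m (suc n)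
consColumn (c , r) (R , S) = zipWith _∷_ c R , r ∷ S

columns : ∀ m → List (Vec Bool m × Vec Bool m)
columns m = cartesianProduct (vecs booleans m) (vecs booleans m)

allPairs : ∀ m n → List (Pair m n)
allPairs m zero    = (replicate m [] , []) ∷ []
allPairs m (suc n) = cartesianProductWith consColumn (columns m) (allPairs m n)

zipWith-∷-injective : ∀ {m n} {c c′ : Vec A m} {R R′ : Vec (Vec A n) m} →
                      zipWith Vec._∷_ c R ≡ zipWith Vec._∷_ c′ R′ → c ≡ c′ × R ≡ R′
zipWith-∷-injective {c = []}    {[]}     {[]}    {[]}     refl = refl , refl
zipWith-∷-injective {c = x ∷ c} {x′ ∷ c′} {r ∷ R} {r′ ∷ R′} e =
  cong₂ _∷_ (cong (Vec.head ∘ Vec.head) e) (proj₁ tails≡) , cong₂ _∷_ (cong (Vec.tail ∘ Vec.head) e) (proj₂ tails≡)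
  where
  tails≡ : c ≡ c′ × R ≡ R′
  tails≡ = zipWith-∷-injective (cong Vec.tail e)

zipWith-∷-head-tail : ∀ {m n} (R : Vec (Vec A (suc n)) m) → zipWith Vec._∷_ (Vec.map Vec.head R) (Vec.map Vec.tail R) ≡ R
zipWith-∷-head-tail []            = refl
zipWith-∷-head-tail ((x ∷ r) ∷ R) = cong ((x ∷ r) ∷_) (zipWith-∷-head-tail R)

replicate-[] : ∀ {m} (R : Vec (Vec A 0) m) → R ≡ replicate m []
replicate-[] []       = refl
replicate-[] ([] ∷ R) = cong ([] ∷_) (replicate-[] R)

consColumn-injective : ∀ {m n} {w w′ : Vec Bool m × Vec Bool m} {q q′ : Pair m n} →
                       consColumn w q ≡ consColumn w′ q′ → w ≡ w′ × q ≡ q′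
consColumn-injective {w = c , r} {c′ , r′} {R , S} {R′ , S′} e
  with refl , refl ← zipWith-∷-injective (,-injectiveˡ e)
     | refl , refl ← Vec.∷-injective (,-injectiveʳ e) = refl , refl

allPairs-unique : ∀ m n → Unique (allPairs m n)
allPairs-unique m zero    = All.[] AllPairs.∷ AllPairs.[]
allPairs-unique m (suc n) =
  Unique.cartesianProductWith⁺ consColumn consColumn-injective
    (Unique.cartesianProduct⁺ (vecs-unique m booleans-unique) (vecs-unique m booleans-unique))
    (allPairs-unique m n)

∈-allPairs : ∀ {m} n (q : Pair m n) → q ∈ allPairs m n
∈-allPairs zero    (R , [])    = subst (λ R → (R , []) ∈ allPairs _ 0) (sym (replicate-[] R)) (here refl)
∈-allPairs (suc n) (R , r ∷ S) = subst (λ R → (R , r ∷ S) ∈ allPairs _ (suc n)) (zipWith-∷-head-tail R)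
  (∈-cartesianProductWith⁺ consColumn
    (∈-cartesianProduct⁺ (∈-vecs ∈-booleans (Vec.map Vec.head R)) (∈-vecs ∈-booleans r))
    (∈-allPairs n (Vec.map Vec.tail R , S)))

∑-allPairs-suc : ∀ m n (f : Pair m (suc n) → ℤ) →
  ∑ (allPairs m (suc n)) f ≡ ∑ (vecs booleans m) (λ c → ∑ (vecs booleans m) (λ r → ∑ (allPairs m n) (f ∘ consColumn (c , r))))
∑-allPairs-suc m n f =
  trans (∑-cartesianProductWith consColumn (columns m) (allPairs m n) f)
        (∑-cartesianProductWith _,_ (vecs booleans m) (vecs booleans m) (λ w → ∑ (allPairs m n) (f ∘ consColumn w)))

dom-zipWith-∷ : ∀ {m n} (c : Vec Bool m) (R : Vec (Vec Bool n) m) → dom (zipWith _∷_ c R) ≡ c ∨v dom R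
dom-zipWith-∷ []      []      = refl
dom-zipWith-∷ (x ∷ c) (r ∷ R) = cong ((x ∨ any r) ∷_) (dom-zipWith-∷ c R)

ran-zipWith-∷ : ∀ {m n} (c : Vec Bool m) (R : Vec (Vec Bool n) m) → ran (zipWith _∷_ c R) ≡ any c ∷ ran R
ran-zipWith-∷ []      []      = refl
ran-zipWith-∷ (x ∷ c) (r ∷ R) = cong ((x ∷ r) ∨v_) (ran-zipWith-∷ c R)

-- u and v are the parts of dom R and ran S contributed by the columns already split off.
properFrom : ∀ {m n} → Vec Bool m → Vec Bool m → Pair m n → Bool
properFrom u v (R , S) = disjoint (u ∨v dom R) (v ∨v ran S) ∧ disjoint (ran R) (dom S)

properFrom-consColumn : ∀ {m n} (u v c r : Vec Bool m) (q : Pair m n) →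
  properFrom u v (consColumn (c , r) q) ≡ compatible c r ∧ properFrom (u ∨v c) (v ∨v r) q
properFrom-consColumn u v c r (R , S) = begin
  disjoint (u ∨v dom (zipWith _∷_ c R)) (v ∨v (r ∨v ran S)) ∧ disjoint (ran (zipWith _∷_ c R)) (any r ∷ dom S)
    ≡⟨ cong₂ (λ d e → disjoint (u ∨v d) (v ∨v (r ∨v ran S)) ∧ disjoint e (any r ∷ dom S)) (dom-zipWith-∷ c R) (ran-zipWith-∷ c R) ⟩
  disjoint (u ∨v (c ∨v dom R)) (v ∨v (r ∨v ran S)) ∧ (compatible c r ∧ disjoint (ran R) (dom S))
    ≡⟨ cong₂ (λ d e → disjoint d e ∧ (compatible c r ∧ disjoint (ran R) (dom S))) (∨v-assoc u c (dom R)) (∨v-assoc v r (ran S)) ⟨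
  disjoint ((u ∨v c) ∨v dom R) ((v ∨v r) ∨v ran S) ∧ (compatible c r ∧ disjoint (ran R) (dom S))
    ≡⟨ ∧.x∙yz≈y∙xz (disjoint ((u ∨v c) ∨v dom R) ((v ∨v r) ∨v ran S)) (compatible c r) (disjoint (ran R) (dom S)) ⟩
  compatible c r ∧ properFrom (u ∨v c) (v ∨v r) (R , S) ∎
  where
  open ≡-Reasoning
  ∨v-assoc : ∀ {k} (x y z : Vec Bool k) → (x ∨v y) ∨v z ≡ x ∨v (y ∨v z)
  ∨v-assoc = Vec.zipWith-assoc Bool.∨-assoc

properFrom-empty : ∀ {m} (u v : Vec Bool m) → properFrom u v (replicate m [] , []) ≡ disjoint u v
properFrom-empty {m} u v = begin
  disjoint (u ∨v dom (replicate m [])) (v ∨v replicate m false) ∧ disjoint (ran (replicate m [])) []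
    ≡⟨ cong₂ _∧_ (cong₂ disjoint (trans (cong (u ∨v_) (Vec.map-replicate any [] m)) (∨v-identityʳ u)) (∨v-identityʳ v))
                 (disjoint-[] (ran (replicate m []))) ⟩
  disjoint u v ∧ true
    ≡⟨ Bool.∧-identityʳ (disjoint u v) ⟩
  disjoint u v ∎
  where
  open ≡-Reasoning
  ∨v-identityʳ : ∀ {k} (x : Vec Bool k) → x ∨v replicate k false ≡ x
  ∨v-identityʳ = Vec.zipWith-identityʳ Bool.∨-identityʳ
  disjoint-[] : (x : Vec Bool 0) → disjoint x [] ≡ true
  disjoint-[] [] = refl

properFrom-replicate : ∀ {m n} (q : Pair m n) → properFrom (replicate m false) (replicate m false) q ≡ properᵇ q
properFrom-replicate (R , S) = cong₂ (λ d r → disjoint d r ∧ disjoint (ran R) (dom S)) (∨v-identityˡ (dom R)) (∨v-identityˡ (ran S))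
  where
  ∨v-identityˡ : ∀ {k} (x : Vec Bool k) → replicate k false ∨v x ≡ x
  ∨v-identityˡ = Vec.zipWith-identityˡ Bool.∨-identityˡ

weight : ∀ {k} → ℕ → Vec Label k → ℤ
weight n ℓ = summand n (occurrences free₁ ℓ) (occurrences free₂ ℓ) (occurrences none ℓ)

∑-properFrom : ∀ m n (u v : Vec Bool m) →
  ∑ (allPairs m n) (λ q → ⟦ properFrom u v q ⟧) ≡ ∑ (vecs labels m) (λ ℓ → ⟦ admits ℓ u v ⟧ * weight n ℓ)
∑-properFrom m zero u v = begin
  ⟦ properFrom u v (replicate m [] , []) ⟧ + + 0
    ≡⟨ trans (ℤ.+-identityʳ _) (cong ⟦_⟧ (properFrom-empty u v)) ⟩
  ⟦ disjoint u v ⟧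
    ≡⟨ disjoint-inclusion-exclusion u v ⟩
  ∑ (vecs labels m) (λ ℓ → ⟦ admits ℓ u v ⟧ * sign ℓ)
    ≡⟨ ∑-cong (vecs labels m) (λ ℓ → cong (_*_ ⟦ admits ℓ u v ⟧) (ℤ.*-identityʳ (sign ℓ))) ⟨
  ∑ (vecs labels m) (λ ℓ → ⟦ admits ℓ u v ⟧ * weight 0 ℓ) ∎
  where open ≡-Reasoning
∑-properFrom m (suc n) u v = begin
  ∑ (allPairs m (suc n)) (λ q → ⟦ properFrom u v q ⟧)
    ≡⟨ ∑-allPairs-suc m n (λ q → ⟦ properFrom u v q ⟧) ⟩
  ∑ 𝔹ᵐ (λ c → ∑ 𝔹ᵐ (λ r → ∑ (allPairs m n) (λ q → ⟦ properFrom u v (consColumn (c , r) q) ⟧)))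
    ≡⟨ ∑-cong 𝔹ᵐ (λ c → ∑-cong 𝔹ᵐ (column c)) ⟩
  ∑ 𝔹ᵐ (λ c → ∑ 𝔹ᵐ (λ r → ∑ ℒ (λ ℓ → (⟦ compatible c r ⟧ * ⟦ admits ℓ c r ⟧) * (⟦ admits ℓ u v ⟧ * weight n ℓ))))
    ≡⟨ ∑-pull 𝔹ᵐ 𝔹ᵐ ℒ (λ c r ℓ → ⟦ compatible c r ⟧ * ⟦ admits ℓ c r ⟧) (λ ℓ → ⟦ admits ℓ u v ⟧ * weight n ℓ) ⟩
  ∑ ℒ (λ ℓ → ∑ 𝔹ᵐ (λ c → ∑ 𝔹ᵐ (λ r → ⟦ compatible c r ⟧ * ⟦ admits ℓ c r ⟧)) * (⟦ admits ℓ u v ⟧ * weight n ℓ))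
    ≡⟨ ∑-cong ℒ (λ ℓ → trans (cong (_* (⟦ admits ℓ u v ⟧ * weight n ℓ)) (∑-compatible ℓ))
                              (regroup (base ℓ) ⟦ admits ℓ u v ⟧ ((- + 1) ℤ.^ occurrences none ℓ) (base ℓ ℤ.^ n))) ⟩
  ∑ ℒ (λ ℓ → ⟦ admits ℓ u v ⟧ * weight (suc n) ℓ) ∎
  where
  open ≡-Reasoning
  𝔹ᵐ : List (Vec Bool m)
  𝔹ᵐ = vecs booleans m
  ℒ : List (Vec Label m)
  ℒ = vecs labels m
  base : Vec Label m → ℤ
  base ℓ = + (2 ℕ.^ occurrences free₁ ℓ) + + (2 ℕ.^ occurrences free₂ ℓ) - + 1
  regroup : ∀ b a s p → b * (a * (s * p)) ≡ a * (s * (b * p))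
  regroup = solve-∀
  column : ∀ c r → ∑ (allPairs m n) (λ q → ⟦ properFrom u v (consColumn (c , r) q) ⟧)
                 ≡ ∑ ℒ (λ ℓ → (⟦ compatible c r ⟧ * ⟦ admits ℓ c r ⟧) * (⟦ admits ℓ u v ⟧ * weight n ℓ))
  column c r = begin
    ∑ (allPairs m n) (λ q → ⟦ properFrom u v (consColumn (c , r) q) ⟧)
      ≡⟨ ∑-cong (allPairs m n) (λ q → trans (cong ⟦_⟧ (properFrom-consColumn u v c r q)) (⟦∧⟧ (compatible c r) _)) ⟩
    ∑ (allPairs m n) (λ q → ⟦ compatible c r ⟧ * ⟦ properFrom (u ∨v c) (v ∨v r) q ⟧)
      ≡⟨ ∑-*ˡ (allPairs m n) ⟦ compatible c r ⟧ _ ⟩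
    ⟦ compatible c r ⟧ * ∑ (allPairs m n) (λ q → ⟦ properFrom (u ∨v c) (v ∨v r) q ⟧)
      ≡⟨ cong (_*_ ⟦ compatible c r ⟧) (∑-properFrom m n (u ∨v c) (v ∨v r)) ⟩
    ⟦ compatible c r ⟧ * ∑ ℒ (λ ℓ → ⟦ admits ℓ (u ∨v c) (v ∨v r) ⟧ * weight n ℓ)
      ≡⟨ ∑-*ˡ ℒ ⟦ compatible c r ⟧ _ ⟨
    ∑ ℒ (λ ℓ → ⟦ compatible c r ⟧ * (⟦ admits ℓ (u ∨v c) (v ∨v r) ⟧ * weight n ℓ))
      ≡⟨ ∑-cong ℒ (λ ℓ → cong (λ b → ⟦ compatible c r ⟧ * (⟦ b ⟧ * weight n ℓ)) (admits-∨ ℓ u v c r)) ⟩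
    ∑ ℒ (λ ℓ → ⟦ compatible c r ⟧ * (⟦ admits ℓ u v ∧ admits ℓ c r ⟧ * weight n ℓ))
      ≡⟨ ∑-cong ℒ (λ ℓ → trans (cong (λ x → ⟦ compatible c r ⟧ * (x * weight n ℓ)) (⟦∧⟧ (admits ℓ u v) (admits ℓ c r)))
                                (shuffle ⟦ compatible c r ⟧ ⟦ admits ℓ u v ⟧ ⟦ admits ℓ c r ⟧ (weight n ℓ))) ⟩
    ∑ ℒ (λ ℓ → (⟦ compatible c r ⟧ * ⟦ admits ℓ c r ⟧) * (⟦ admits ℓ u v ⟧ * weight n ℓ)) ∎
    where
    shuffle : ∀ k a b w → k * ((a * b) * w) ≡ (k * b) * (a * w)
    shuffle = solve-∀

properPairs : ∀ m n → List (Pair m n)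
properPairs m n = filterᵇ properᵇ (allPairs m n)

∈-properPairs⇔ : ∀ {m n} (R : Rel₁₂ m n) (S : Rel₁₂ n m) → (R , S) ∈ properPairs m n ⇔ IsProperMerging R S
∈-properPairs⇔ {m} {n} R S = ⇔.trans
  (mk⇔ (λ p → Equivalence.to Bool.T-≡ (proj₂ (∈-filter⁻ (T? ∘ properᵇ) {xs = allPairs m n} p)))
       (λ e → ∈-filter⁺ (T? ∘ properᵇ) (∈-allPairs n (R , S)) (Equivalence.from Bool.T-≡ e)))
  (properᵇ⇔ R S)

length-properPairs : ∀ m n → + length (properPairs m n) ≡ rhs m n
length-properPairs m n = begin
  + length (properPairs m n)
    ≡⟨ length-filterᵇ properᵇ (allPairs m n) ⟩
  ∑ (allPairs m n) (⟦_⟧ ∘ properᵇ)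
    ≡⟨ ∑-cong (allPairs m n) (λ q → cong ⟦_⟧ (properFrom-replicate q)) ⟨
  ∑ (allPairs m n) (λ q → ⟦ properFrom 𝟘 𝟘 q ⟧)
    ≡⟨ ∑-properFrom m n 𝟘 𝟘 ⟩
  ∑ (vecs labels m) (λ ℓ → ⟦ admits ℓ 𝟘 𝟘 ⟧ * weight n ℓ)
    ≡⟨ ∑-cong (vecs labels m) (λ ℓ → cong (λ b → ⟦ b ⟧ * weight n ℓ)
         (cong₂ _∧_ (supportedOn-replicate free₁ ℓ) (supportedOn-replicate free₂ ℓ))) ⟩
  ∑ (vecs labels m) (λ ℓ → + 1 * weight n ℓ)
    ≡⟨ ∑-cong (vecs labels m) (λ ℓ → ℤ.*-identityˡ (weight n ℓ)) ⟩
  ∑ (vecs labels m) (weight n)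
    ≡⟨ ∑-labellings m (summand n) ⟩
  pascalSum m (λ i r → pascalSum r (summand n i))
    ≡⟨ rhs≡pascalSum m n ⟨
  rhs m n ∎
  where
  open ≡-Reasoning
  𝟘 : Vec Bool m
  𝟘 = replicate m false

theorem4p1 : (m n : ℕ) →
    Σ ℕ (λ N → NumProperMergings m n N × (+ N) ≡ rhs m n)
theorem4p1 m n =
  length (properPairs m n) ,
  (properPairs m n , Unique.filter⁺ (T? ∘ properᵇ) (allPairs-unique m n) , ∈-properPairs⇔ , refl) ,
  length-properPairs m n
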